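{- Let $\mathcal{F}$ be an ABA-free hypergraph on a finite totally ordered vertex set $V$ and let $v\in V$ be skippable. Let $l$ be the unskippable vertex smaller than $v$ closest to $v$, and $r$ the unskippable vertex larger than $v$ closest to $v$. Then every hyperedge $H\in\mathcal{F}$ with $v\in H$ contains at least one of $l$ and $r$.
   Context: A hypergraph $\mathcal{F}$ on a totally ordered finite vertex set $V$ is ABA-free if there are no two hyperedges $A,B\in\mathcal{F}$ and vertices $x<y<z$ with $x,z\in A\setminus B$ and $y\in B\setminus A$. A vertex $a$ is skippable in $\mathcal{F}$ if there exists $A\in\mathcal{F}$ with $\min(A)<a<\max(A)$ and $a\notin A$; otherwise $a$ is unskippable. (The smallest and largest vertices of $V$ are always unskippable, so $l$ and $r$ exist.) -}

module Defs where

open import Data.Nat using (ℕ)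
open import Data.Fin using (Fin; _<_)
open import Data.Fin.Subset using (Subset; _∈_; _∉_)
open import Data.List using (List)
open import Data.List.Membership.Propositional using () renaming (_∈_ to _∈ₗ_)
open import Data.Product using (∃; ∃-syntax; _×_)
open import Relation.Nullary using (¬_)

-- Vertex set V = Fin n with its natural total order (every finite
-- totally ordered set is order-isomorphic to some Fin n).
-- A hypergraph is a finite list of hyperedges, each a subset of V.
Hypergraph : ℕ → Set
Hypergraph n = List (Subset n)

ABA-free : {n : ℕ} → Hypergraph n → Set
ABA-free {n} F =
  ∀ (A B : Subset n) → A ∈ₗ F → B ∈ₗ F →
  ∀ (x y z : Fin n) → x < y → y < z →
  ¬ ((x ∈ A × x ∉ B) × (z ∈ A × z ∉ B) × (y ∈ B × y ∉ A))

-- a is skippable: some A ∈ F with min A < a < max A and a ∉ A.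
-- (min A < a < max A  iff  A has elements x, z with x < a < z.)
Skippable : {n : ℕ} → Hypergraph n → Fin n → Set
Skippable {n} F a =
  ∃[ A ] (A ∈ₗ F × a ∉ A × (∃[ x ] (x ∈ A × x < a)) × (∃[ z ] (z ∈ A × a < z)))

Unskippable : {n : ℕ} → Hypergraph n → Fin n → Set
Unskippable F a = ¬ Skippable F a

IsClosestUnskippableBelow : {n : ℕ} → Hypergraph n → Fin n → Fin n → Set
IsClosestUnskippableBelow {n} F v l =
  l < v × Unskippable F l × (∀ (w : Fin n) → l < w → w < v → Skippable F w)

IsClosestUnskippableAbove : {n : ℕ} → Hypergraph n → Fin n → Fin n → Set
IsClosestUnskippableAbove {n} F v r =
  v < r × Unskippable F r × (∀ (w : Fin n) → v < w → w < r → Skippable F w)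

{-# OPTIONS --safe #-}
module Submission where

-- Every nonempty hyperedge E of an ABA-free hypergraph contains an unskippable
-- vertex. If a hyperedge S skips p ∈ E, either S ⊂ E, and we recurse on the
-- smaller hyperedge S, or S has a vertex y ∉ E; then ABA-freeness of S and E
-- puts every vertex q of S on the far side of p from y into E, and we jump from
-- p to q. Jumps compose (again by ABA-freeness), so they form a strict partial
-- order on the finite vertex set and cannot go on forever. If H contains neither
-- l nor r, then H lies strictly between them because they are unskippable, and
-- every vertex there is skippable.

open import Defs
open import Data.Nat using (ℕ)
open import Data.Fin using (Fin)
open import Data.Fin.Subset using (Subset; _∈_)
open import Data.List.Membership.Propositional using () renaming (_∈_ to _∈ₗ_)
open import Data.Sum using (_⊎_)

open import Level using (Level; 0ℓ)
open import Function using (_∘_; _on_; flip)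
import Data.Nat as ℕ
open import Data.Nat.Induction using (<-wellFounded)
open import Data.Fin using (_<_)
open import Data.Fin.Properties using (<-cmp; <-isStrictTotalOrder; any?)
open import Data.Fin.Induction using (spo-wellFounded)
open import Data.Fin.Subset using (_∉_; _⊆_; _⊂_; ∣_∣; Nonempty)
open import Data.Fin.Subset.Properties using (_∈?_; p⊂q⇒∣p∣<∣q∣)
open import Data.Product using (∃-syntax; _×_; _,_; proj₁)
import Data.Product as Product
open import Data.Sum using (inj₁; inj₂)
import Data.Sum as Sum
open import Data.Empty using (⊥; ⊥-elim)
open import Induction.WellFounded using (WellFounded; Acc; acc)
open import Relation.Binary using (Rel; IsStrictTotalOrder; IsStrictPartialOrder; tri<; tri≈; tri>)
import Relation.Binary.Construct.Flip.EqAndOrd as Flip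
import Relation.Binary.Construct.On as On
open import Relation.Binary.PropositionalEquality using (_≡_; refl; sym; subst; isEquivalence; resp₂)
open import Relation.Nullary using (¬_; yes; no; ¬?; _×-dec_)
open import Relation.Nullary.Decidable using (decidable-stable)

private
  variable
    a ℓ : Level
    A : Set a
    n : ℕ
    F : Hypergraph n
    E : Subset n
    p q r : Fin n

-- ABA-free F is ABA-free-for _<_ F; the general order lets the reversed order
-- handle the mirror-image cases.
ABA-free-for : Rel (Fin n) 0ℓ → Hypergraph n → Set
ABA-free-for {n} _≺_ F =
  ∀ (A B : Subset n) → A ∈ₗ F → B ∈ₗ F →
  ∀ (x y z : Fin n) → x ≺ y → y ≺ z →
  ¬ ((x ∈ A × x ∉ B) × (z ∈ A × z ∉ B) × (y ∈ B × y ∉ A))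

ABA-free-flip : {_≺_ : Rel (Fin n) 0ℓ} →
                ABA-free-for _≺_ F → ABA-free-for (flip _≺_) F
ABA-free-flip aba A B A∈F B∈F x y z y≺x z≺y (x∈A∖B , z∈A∖B , y∈B∖A) =
  aba A B A∈F B∈F z y x z≺y y≺x (z∈A∖B , x∈A∖B , y∈B∖A)

Between : Rel A ℓ → A → A → A → Set ℓ
Between _≺_ x y z = (x ≺ y × y ≺ z) ⊎ (z ≺ y × y ≺ x)

Between-flip : {_≺_ : Rel A ℓ} {x y z : A} →
               Between (flip _≺_) x y z → Between _≺_ x y z
Between-flip = Sum.swap ∘ Sum.map Product.swap Product.swap

Jump : Hypergraph n → Rel (Fin n) 0ℓ → Subset n → Fin n → Fin n → Set
Jump F _≺_ E p q =
  ∃[ S ] (S ∈ₗ F × p ∉ S × q ∈ S × ∃[ y ] (y ∈ S × y ∉ E × Between _≺_ y p q))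

Jump-flip : {_≺_ : Rel (Fin n) 0ℓ} → Jump F (flip _≺_) E p q → Jump F _≺_ E p q
Jump-flip {_≺_ = _≺_} (S , S∈F , p∉S , q∈S , y , y∈S , y∉E , y-p-q) =
  S , S∈F , p∉S , q∈S , y , y∈S , y∉E , Between-flip {_≺_ = _≺_} y-p-q

module Oriented {_≺_ : Rel (Fin n) 0ℓ} (≺-isSTO : IsStrictTotalOrder _≡_ _≺_)
                (aba : ABA-free-for _≺_ F) (E∈F : E ∈ₗ F) where

  open IsStrictTotalOrder ≺-isSTO using (compare) renaming (trans to ≺-trans)

  aba-between : ∀ {A B x y z} → A ∈ₗ F → B ∈ₗ F → Between _≺_ x y z →
                x ∈ A → x ∉ B → z ∈ A → z ∉ B → y ∈ B → y ∉ A → ⊥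
  aba-between A∈F B∈F (inj₁ (x≺y , y≺z)) x∈A x∉B z∈A z∉B y∈B y∉A =
    aba _ _ A∈F B∈F _ _ _ x≺y y≺z ((x∈A , x∉B) , (z∈A , z∉B) , (y∈B , y∉A))
  aba-between A∈F B∈F (inj₂ (z≺y , y≺x)) x∈A x∉B z∈A z∉B y∈B y∉A =
    aba _ _ A∈F B∈F _ _ _ z≺y y≺x ((z∈A , z∉B) , (x∈A , x∉B) , (y∈B , y∉A))

  shielded : ∀ {S y s} → S ∈ₗ F → p ∈ E → p ∉ S → y ∈ S → y ∉ E →
             Between _≺_ y p s → s ∈ S → s ∈ E
  shielded {s = s} S∈F p∈E p∉S y∈S y∉E y-p-s s∈S with s ∈? E
  ... | yes s∈E = s∈E
  ... | no s∉E = ⊥-elim (aba-between S∈F E∈F y-p-s y∈S y∉E s∈S s∉E p∈E p∉S)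

  jump-trans-from-below : ∀ {S y} → p ∈ E → S ∈ₗ F → p ∉ S → q ∈ S →
                          y ∈ S → y ∉ E → y ≺ p → p ≺ q →
                          Jump F _≺_ E q r → Jump F _≺_ E p r
  jump-trans-from-below {p} {q} {r} {S} {y} p∈E S∈F p∉S q∈S y∈S y∉E y≺p p≺q
                        (T , T∈F , q∉T , r∈T , y′ , y′∈T , y′∉E , y′-q-r) = by-cases y′-q-r
    where
    via-S : r ∈ S → p ≺ r → Jump F _≺_ E p r
    via-S r∈S p≺r = S , S∈F , p∉S , r∈S , y , y∈S , y∉E , inj₁ (y≺p , p≺r)

    via-T : p ∉ T → Between _≺_ y′ p r → Jump F _≺_ E p r
    via-T p∉T y′-p-r = T , T∈F , p∉T , r∈T , y′ , y′∈T , y′∉E , y′-p-r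

    -- S ∖ E lies on y's side of p.
    far-∉S : p ≺ y′ → y′ ∉ S
    far-∉S p≺y′ y′∈S = y′∉E (shielded S∈F p∈E p∉S y∈S y∉E (inj₁ (y≺p , p≺y′)) y′∈S)

    -- Otherwise T ∖ S would have vertices on both sides of q ∈ S ∖ T.
    r∈S : y′ ∉ S → r ∈ S
    r∈S y′∉S with r ∈? S
    ... | yes r∈S = r∈S
    ... | no r∉S = ⊥-elim (aba-between T∈F S∈F y′-q-r y′∈T y′∉S r∈T r∉S q∈S q∉T)

    by-cases : Between _≺_ y′ q r → Jump F _≺_ E p r
    by-cases (inj₁ (y′≺q , q≺r)) with compare y′ p
    ... | tri≈ _ y′≡p _ = ⊥-elim (y′∉E (subst (_∈ E) (sym y′≡p) p∈E))
    ... | tri> _ _ p≺y′ = via-S (r∈S (far-∉S p≺y′)) (≺-trans p≺q q≺r)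
    ... | tri< y′≺p _ _ with p ∈? T | r ∈? S
    ...   | no p∉T | _ = via-T p∉T (inj₁ (y′≺p , ≺-trans p≺q q≺r))
    ...   | yes _ | yes r∈S = via-S r∈S (≺-trans p≺q q≺r)
    ...   | yes p∈T | no r∉S =
            ⊥-elim (aba-between T∈F S∈F (inj₁ (p≺q , q≺r)) p∈T p∉S r∈T r∉S q∈S q∉T)
    by-cases (inj₂ (r≺q , q≺y′)) with compare r p
    ... | tri> _ _ p≺r = via-S (r∈S (far-∉S (≺-trans p≺q q≺y′))) p≺r
    ... | tri≈ _ r≡p _ = ⊥-elim (p∉S (subst (_∈ S) r≡p (r∈S (far-∉S (≺-trans p≺q q≺y′)))))
    ... | tri< r≺p _ _ with p ∈? T
    ...   | no p∉T = via-T p∉T (inj₂ (r≺p , ≺-trans p≺q q≺y′))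
    ...   | yes p∈T = ⊥-elim (aba-between T∈F S∈F (inj₁ (p≺q , q≺y′))
                                p∈T p∉S y′∈T (far-∉S (≺-trans p≺q q≺y′)) q∈S q∉T)

module JumpOrder {F : Hypergraph n} (aba : ABA-free F) (E∈F : E ∈ₗ F) where

  private
    module Up = Oriented <-isStrictTotalOrder aba E∈F
    module Down = Oriented (Flip.isStrictTotalOrder <-isStrictTotalOrder) (ABA-free-flip aba) E∈F

  jump-∈ : p ∈ E → Jump F _<_ E p q → q ∈ E
  jump-∈ p∈E (S , S∈F , p∉S , q∈S , y , y∈S , y∉E , y-p-q) =
    Up.shielded S∈F p∈E p∉S y∈S y∉E y-p-q q∈S

  jump-trans : p ∈ E → Jump F _<_ E p q → Jump F _<_ E q r → Jump F _<_ E p r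
  jump-trans p∈E (S , S∈F , p∉S , q∈S , y , y∈S , y∉E , inj₁ (y<p , p<q)) q⇝r =
    Up.jump-trans-from-below p∈E S∈F p∉S q∈S y∈S y∉E y<p p<q q⇝r
  jump-trans p∈E (S , S∈F , p∉S , q∈S , y , y∈S , y∉E , inj₂ (q<p , p<y)) q⇝r =
    Jump-flip {_≺_ = _<_} (Down.jump-trans-from-below p∈E S∈F p∉S q∈S y∈S y∉E p<y q<p
                (Jump-flip {_≺_ = flip _<_} q⇝r))

  _◁_ : Rel (Fin n) 0ℓ
  q ◁ p = p ∈ E × Jump F _<_ E p q

  ◁-isStrictPartialOrder : IsStrictPartialOrder _≡_ _◁_
  ◁-isStrictPartialOrder = record
    { isEquivalence = isEquivalence
    ; irrefl = λ { refl (_ , _ , _ , p∉S , p∈S , _) → p∉S p∈S }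
    ; trans = λ { (_ , q⇝p) (r∈E , r⇝q) → r∈E , jump-trans r∈E r⇝q q⇝p }
    ; <-resp-≈ = resp₂ _◁_
    }

  ◁-wellFounded : WellFounded _◁_
  ◁-wellFounded = spo-wellFounded ◁-isStrictPartialOrder

AllSkippable : Hypergraph n → Subset n → Set
AllSkippable F E = ∀ p → p ∈ E → Skippable F p

skipped-by-subedge-or-jump : p ∈ E → Skippable F p →
                             (∃[ S ] (S ∈ₗ F × S ⊂ E × Nonempty S)) ⊎ ∃[ q ] Jump F _<_ E p q
skipped-by-subedge-or-jump {p = p} {E = E} p∈E (S , S∈F , p∉S , (x , x∈S , x<p) , (z , z∈S , p<z))
  with any? (λ y → y ∈? S ×-dec ¬? (y ∈? E))
... | yes (y , y∈S , y∉E) with <-cmp y p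
...   | tri< y<p _ _ = inj₂ (z , S , S∈F , p∉S , z∈S , y , y∈S , y∉E , inj₁ (y<p , p<z))
...   | tri≈ _ y≡p _ = ⊥-elim (p∉S (subst (_∈ S) y≡p y∈S))
...   | tri> _ _ p<y = inj₂ (x , S , S∈F , p∉S , x∈S , y , y∈S , y∉E , inj₂ (x<p , p<y))
skipped-by-subedge-or-jump {p = p} {E = E} p∈E (S , S∈F , p∉S , (x , x∈S , _) , _)
    | no S⊈E = inj₁ (S , S∈F , (S⊆E , p , p∈E , p∉S) , x , x∈S)
  where
  S⊆E : S ⊆ E
  S⊆E {y} y∈S = decidable-stable (y ∈? E) (λ y∉E → S⊈E (y , y∈S , y∉E))

hyperedge-not-all-skippable : ABA-free F → E ∈ₗ F → Nonempty E → ¬ AllSkippable F E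
hyperedge-not-all-skippable {F = F} aba E∈F (p , p∈E) =
  by-size (On.wellFounded ∣_∣ <-wellFounded _) E∈F p∈E
  where
  by-size : ∀ {E p} → Acc (ℕ._<_ on ∣_∣) E → E ∈ₗ F → p ∈ E → ¬ AllSkippable F E
  by-size {E} (acc smaller) E∈F p∈E all-skippable = along-jumps (◁-wellFounded _) p∈E
    where
    open JumpOrder aba E∈F

    along-jumps : ∀ {p} → Acc _◁_ p → p ∈ E → ⊥
    along-jumps (acc further) p∈E with skipped-by-subedge-or-jump p∈E (all-skippable _ p∈E)
    ... | inj₁ (S , S∈F , S⊂E , q , q∈S) =
          by-size (smaller (p⊂q⇒∣p∣<∣q∣ S⊂E)) S∈F q∈S
                  (λ s s∈S → all-skippable s (proj₁ S⊂E s∈S))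
    ... | inj₂ (q , p⇝q) = along-jumps (further (p∈E , p⇝q)) (jump-∈ p∈E p⇝q)

∉-unskippable-below : ∀ {H v h l} → Unskippable F l → H ∈ₗ F → l ∉ H → v ∈ H → l < v →
                      h ∈ H → l < h
∉-unskippable-below {H = H} {v} {h} {l} l-unskippable H∈F l∉H v∈H l<v h∈H with <-cmp h l
... | tri< h<l _ _ = ⊥-elim (l-unskippable (H , H∈F , l∉H , (h , h∈H , h<l) , (v , v∈H , l<v)))
... | tri≈ _ h≡l _ = ⊥-elim (l∉H (subst (_∈ H) h≡l h∈H))
... | tri> _ _ l<h = l<h

∉-unskippable-above : ∀ {H v h r} → Unskippable F r → H ∈ₗ F → r ∉ H → v ∈ H → v < r →
                      h ∈ H → h < r
∉-unskippable-above {H = H} {v} {h} {r} r-unskippable H∈F r∉H v∈H v<r h∈H with <-cmp h r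
... | tri< h<r _ _ = h<r
... | tri≈ _ h≡r _ = ⊥-elim (r∉H (subst (_∈ H) h≡r h∈H))
... | tri> _ _ r<h = ⊥-elim (r-unskippable (H , H∈F , r∉H , (v , v∈H , v<r) , (h , h∈H , r<h)))

mainTheorem12 : ∀ {n : ℕ} (F : Hypergraph n) → ABA-free F →
    ∀ (v l r : Fin n) → Skippable F v →
    IsClosestUnskippableBelow F v l → IsClosestUnskippableAbove F v r →
    ∀ (H : Subset n) → H ∈ₗ F → v ∈ H → (l ∈ H ⊎ r ∈ H)
mainTheorem12 F aba v l r v-skippable (l<v , l-unskippable , l-gap) (v<r , r-unskippable , r-gap)
              H H∈F v∈H with l ∈? H | r ∈? H
... | yes l∈H | _ = inj₁ l∈H
... | no _ | yes r∈H = inj₂ r∈H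
... | no l∉H | no r∉H = ⊥-elim (hyperedge-not-all-skippable aba H∈F (v , v∈H) all-skippable)
  where
  all-skippable : AllSkippable F H
  all-skippable h h∈H with <-cmp h v
  ... | tri< h<v _ _ = l-gap h (∉-unskippable-below l-unskippable H∈F l∉H v∈H l<v h∈H) h<v
  ... | tri≈ _ refl _ = v-skippable
  ... | tri> _ _ v<h = r-gap h v<h (∉-unskippable-above r-unskippable H∈F r∉H v∈H v<r h∈H)
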